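{- Let $G=(V,E)$ be a graph with $\mathrm{nd}(G)=\nu$ and let $\alpha_1,\dots,\alpha_\ell$ be local linear cardinality constraints. Then there exist a neighborhood diversity decomposition $\mathcal{T}$ of $G$ with $|\mathcal{T}|\le\nu\cdot 4^{\ell}$ and local linear cardinality constraints $\alpha_1',\dots,\alpha_\ell'$ such that: every $\alpha_i'$ is uniform with respect to $\mathcal{T}$ (i.e., every type of $\mathcal{T}$ is uniform with respect to every $\alpha'_i$), and for every tuple $(X_1,\dots,X_\ell)$ of subsets of $V$, $X_i$ satisfies $\alpha_i$ for all $i\in[\ell]$ if and only if $X_i$ satisfies $\alpha_i'$ for all $i\in[\ell]$.
   Context: Graphs are finite, simple and undirected with $n=|V|$; $N(v)$ is the open neighbourhood of $v$ and $X(v)=X\cap N(v)$. Two distinct vertices $u,v$ are of the same neighborhood type if $N(u)\setminus\{v\}=N(v)\setminus\{u\}$. A neighborhood diversity decomposition of $G$ is a partition of $V$ into classes (types) in each of which all vertices are pairwise of the same neighborhood type; $\mathrm{nd}(G)$ is the minimum number of classes of such a partition. Local linear cardinality constraints are a map $\alpha$ assigning to each $v\in V$ an integer interval $\alpha(v)\subseteq\{0,\dots,n\}$; $X\subseteq V$ satisfies $\alpha$ if $|X(v)|\in\alpha(v)$ for all $v\in V$. A type $T$ is uniform with respect to $\alpha$ if $\alpha(u)=\alpha(v)$ for all $u,v\in T$. -}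

module Defs where

open import Data.Nat using (ℕ; _≤_; _*_; _^_)
open import Data.Bool using (Bool)
open import Data.Fin using (Fin)
open import Data.Fin.Subset using (Subset; _∩_; ∣_∣)
open import Data.Vec using (tabulate)
open import Data.Product using (Σ; _×_; ∃)
open import Relation.Binary.PropositionalEquality using (_≡_; _≢_)
open import Function.Definitions using (Surjective)

record Graph (n : ℕ) : Set where
  field
    adj   : Fin n → Fin n → Bool
    sym   : ∀ u v → adj u v ≡ adj v u
    irrefl : ∀ v → adj v v ≡ Bool.false
open Graph public

N : ∀ {n} → Graph n → Fin n → Subset n
N G v = tabulate (adj G v)

SameType : ∀ {n} → Graph n → Fin n → Fin n → Set
SameType G u v = ∀ w → w ≢ u → w ≢ v → adj G u w ≡ adj G v w

-- A neighborhood diversity decomposition with exactly k classes (types):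
-- a surjective labelling t : V → Fin k (the classes are the nonempty fibres),
-- such that distinct vertices in the same class are of the same type.
IsNDDecomp : ∀ {n} → Graph n → (k : ℕ) → (Fin n → Fin k) → Set
IsNDDecomp G k t =
  Surjective _≡_ _≡_ t × (∀ u v → u ≢ v → t u ≡ t v → SameType G u v)

HasND : ∀ {n} → Graph n → ℕ → Set
HasND {n} G ν =
  (Σ (Fin n → Fin ν) (IsNDDecomp G ν)) ×
  (∀ k (t : Fin n → Fin k) → IsNDDecomp G k t → ν ≤ k)

-- an integer interval [lo, hi] ⊆ {0,…,n} (empty when lo > hi)
record Interval (n : ℕ) : Set where
  constructor [_,_]⟨_⟩
  field
    lo : ℕ
    hi : ℕ
    hi≤n : hi ≤ n
open Interval public

_∈I_ : ∀ {n} → ℕ → Interval n → Set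
k ∈I I = lo I ≤ k × k ≤ hi I

LCC : ℕ → Set
LCC n = Fin n → Interval n

Satisfies : ∀ {n} → Graph n → Subset n → LCC n → Set
Satisfies G X α = ∀ v → ∣ X ∩ N G v ∣ ∈I α v

Uniform : ∀ {n k} → (Fin n → Fin k) → LCC n → Set
Uniform t α = ∀ u v → t u ≡ t v → α u ≡ α v

-- Two vertices of the same type have neighbourhoods that agree outside each
-- other, so their X-degrees differ by at most one. Hence, for a type c, any X
-- satisfying a constraint has all X-degrees in c at least (max of the lower bounds
-- on c) − 1 and at most (min of the upper bounds on c) + 1. A lower bound below
-- that maximum can therefore be raised to maximum − 1, and an upper bound above
-- the minimum lowered to minimum + 1, without changing the solutions. After this
-- each bound on c takes one of two values, so splitting every type by these two
-- bits per constraint yields at most ν · 4^ℓ types on which all constraints are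
-- uniform.
module Submission where

open import Defs hiding (sym)
open import Data.Nat using (ℕ; zero; suc; _≤_; _*_; _^_; _+_; _∸_; _⊓_; z≤n; s≤s)
open import Data.Nat.Properties as ℕ
  using (≤-trans; ∸-monoˡ-≤; m∸n≤m; m≤n+m∸n; m≤n⇒m≤1+n; ≤∧≢⇒<; ⊓-glb; m⊓n≤m; m⊓n≤n)
open import Data.Bool using (true)
open import Data.Fin using (Fin; zero; suc; toℕ; combine; funToFin; finToFun; _≟_)
open import Data.Fin.Properties using (any?; suc-injective; combine-injective; finToFun-funToFin; injective⇒≤)
open import Data.Fin.Subset using (Subset; _∩_; ∣_∣; _∈_; inside; outside)
open import Data.Fin.Subset.Properties using (p⊆q⇒∣p∣≤∣q∣; ∣p∣≤∣x∷p∣; ∣p∣≤n; drop-there; x∈p∩q⁺; x∈p∩q⁻)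
open import Data.List using (List; map; filter; allFin)
open import Data.List.Extrema.Nat using (max; min; max≤v⁺; v≤min⁺; xs≤max; min≤xs)
open import Data.List.Membership.Propositional using () renaming (_∈_ to _∈ˡ_)
open import Data.List.Membership.Propositional.Properties using (∈-map⁺; ∈-filter⁺; ∈-allFin)
open import Data.List.Relation.Unary.All as All using (All)
open import Data.List.Relation.Unary.All.Properties using (all-filter; map⁺)
open import Data.Vec using (_∷_; here; there)
open import Data.Vec.Properties using ([]=⇒lookup; lookup⇒[]=; lookup∘tabulate)
open import Data.Product using (Σ; _×_; ∃; _,_; proj₁; proj₂)
open import Function using (_∘_)
open import Function.Bundles using (_⇔_; mk⇔; Equivalence)
open import Function.Definitions using (Surjective)
open import Relation.Nullary using (Dec; yes; no; contradiction)
open import Relation.Binary.PropositionalEquality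
  using (_≡_; _≢_; refl; sym; trans; cong; cong₂; subst; module ≡-Reasoning)

∣p∣≤1+∣q∣ : ∀ {m} (p q : Subset m) (x : Fin m) →
            (∀ {y} → y ≢ x → y ∈ p → y ∈ q) → ∣ p ∣ ≤ suc ∣ q ∣
∣p∣≤1+∣q∣ (inside ∷ p) (s ∷ q) zero p⊆q =
  s≤s (≤-trans (p⊆q⇒∣p∣≤∣q∣ (drop-there ∘ p⊆q (λ ()) ∘ there)) (∣p∣≤∣x∷p∣ s q))
∣p∣≤1+∣q∣ (outside ∷ p) (s ∷ q) zero p⊆q =
  m≤n⇒m≤1+n (≤-trans (p⊆q⇒∣p∣≤∣q∣ (drop-there ∘ p⊆q (λ ()) ∘ there)) (∣p∣≤∣x∷p∣ s q))
∣p∣≤1+∣q∣ (inside ∷ p) (inside ∷ q) (suc x) p⊆q =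
  s≤s (∣p∣≤1+∣q∣ p q x (λ y≢x → drop-there ∘ p⊆q (y≢x ∘ suc-injective) ∘ there))
∣p∣≤1+∣q∣ (inside ∷ p) (outside ∷ q) (suc x) p⊆q with p⊆q (λ ()) here
... | ()
∣p∣≤1+∣q∣ (outside ∷ p) (s ∷ q) (suc x) p⊆q =
  ≤-trans (∣p∣≤1+∣q∣ p q x (λ y≢x → drop-there ∘ p⊆q (y≢x ∘ suc-injective) ∘ there))
          (s≤s (∣p∣≤∣x∷p∣ s q))

module _ {n} (G : Graph n) where

  ∈N⇒adj : ∀ {v w} → w ∈ N G v → adj G v w ≡ true
  ∈N⇒adj {v} {w} w∈N = trans (sym (lookup∘tabulate (adj G v) w)) ([]=⇒lookup w∈N)

  adj⇒∈N : ∀ {v w} → adj G v w ≡ true → w ∈ N G v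
  adj⇒∈N {v} {w} e = lookup⇒[]= w (N G v) (trans (lookup∘tabulate (adj G v) w) e)

  adj⇒≢ : ∀ {v w} → adj G v w ≡ true → w ≢ v
  adj⇒≢ {v} e refl with trans (sym e) (irrefl G v)
  ... | ()

  sameType⇒∣X∩N∣≤1+∣X∩N∣ : ∀ X {u v} → SameType G u v →
                            ∣ X ∩ N G u ∣ ≤ suc ∣ X ∩ N G v ∣
  sameType⇒∣X∩N∣≤1+∣X∩N∣ X {u} {v} same = ∣p∣≤1+∣q∣ _ _ v X∩Nu⊆X∩Nv
    where
    X∩Nu⊆X∩Nv : ∀ {w} → w ≢ v → w ∈ X ∩ N G u → w ∈ X ∩ N G v
    X∩Nu⊆X∩Nv {w} w≢v w∈ with x∈p∩q⁻ X (N G u) w∈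
    ... | w∈X , w∈Nu = x∈p∩q⁺ (w∈X , adj⇒∈N (trans (sym (same w (adj⇒≢ uw) w≢v)) uw))
      where uw = ∈N⇒adj w∈Nu

  classmates⇒sameType : ∀ {k} {t : Fin n → Fin k} →
    (∀ u v → u ≢ v → t u ≡ t v → SameType G u v) → ∀ {u v} → t u ≡ t v → SameType G u v
  classmates⇒sameType same {u} {v} tu≡tv with u ≟ v
  ... | yes refl = λ _ _ _ → refl
  ... | no u≢v   = same u v u≢v tu≡tv

record ImageLabelling {m K} (f : Fin m → Fin K) : Set where
  field
    size       : ℕ
    label      : Fin m → Fin size
    surjective : Surjective _≡_ _≡_ label
    label≡⇒f≡  : ∀ u v → label u ≡ label v → f u ≡ f v
    f≡⇒label≡  : ∀ u v → f u ≡ f v → label u ≡ label v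

  size≤ : size ≤ K
  size≤ = injective⇒≤ {f = f ∘ preimage} preimage-injective
    where
    preimage : Fin size → Fin m
    preimage j = proj₁ (surjective j)

    preimage-injective : ∀ {i j} → f (preimage i) ≡ f (preimage j) → i ≡ j
    preimage-injective {i} {j} e =
      trans (sym (proj₂ (surjective i) refl))
            (trans (f≡⇒label≡ _ _ e) (proj₂ (surjective j) refl))

imageLabelling : ∀ {m K} (f : Fin m → Fin K) → ImageLabelling f
imageLabelling {zero} f = record
  { size = 0 ; label = λ () ; surjective = λ () ; label≡⇒f≡ = λ () ; f≡⇒label≡ = λ () }
imageLabelling {suc m} f with imageLabelling (f ∘ suc) | any? (λ u → f zero ≟ f (suc u))
... | r | yes (u₀ , f0≡fu₀) = record
  { size = size ; label = label′ ; surjective = surjective′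
  ; label≡⇒f≡ = label≡⇒f≡′ ; f≡⇒label≡ = f≡⇒label≡′ }
  where
  open ImageLabelling r

  label′ : Fin (suc m) → Fin size
  label′ zero    = label u₀
  label′ (suc u) = label u

  surjective′ : Surjective _≡_ _≡_ label′
  surjective′ j = suc (proj₁ (surjective j)) , λ { refl → proj₂ (surjective j) refl }

  label≡⇒f≡′ : ∀ u v → label′ u ≡ label′ v → f u ≡ f v
  label≡⇒f≡′ zero    zero    _ = refl
  label≡⇒f≡′ zero    (suc v) e = trans f0≡fu₀ (label≡⇒f≡ u₀ v e)
  label≡⇒f≡′ (suc u) zero    e = trans (label≡⇒f≡ u u₀ e) (sym f0≡fu₀)
  label≡⇒f≡′ (suc u) (suc v) e = label≡⇒f≡ u v e

  f≡⇒label≡′ : ∀ u v → f u ≡ f v → label′ u ≡ label′ v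
  f≡⇒label≡′ zero    zero    _ = refl
  f≡⇒label≡′ zero    (suc v) e = f≡⇒label≡ u₀ v (trans (sym f0≡fu₀) e)
  f≡⇒label≡′ (suc u) zero    e = f≡⇒label≡ u u₀ (trans e f0≡fu₀)
  f≡⇒label≡′ (suc u) (suc v) e = f≡⇒label≡ u v e
... | r | no f0-new = record
  { size = suc size ; label = label′ ; surjective = surjective′
  ; label≡⇒f≡ = label≡⇒f≡′ ; f≡⇒label≡ = f≡⇒label≡′ }
  where
  open ImageLabelling r

  label′ : Fin (suc m) → Fin (suc size)
  label′ zero    = zero
  label′ (suc u) = suc (label u)

  surjective′ : Surjective _≡_ _≡_ label′
  surjective′ zero    = zero , λ { refl → refl }
  surjective′ (suc j) = suc (proj₁ (surjective j)) , λ { refl → cong suc (proj₂ (surjective j) refl) }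

  label≡⇒f≡′ : ∀ u v → label′ u ≡ label′ v → f u ≡ f v
  label≡⇒f≡′ zero    zero    _ = refl
  label≡⇒f≡′ (suc u) (suc v) e = label≡⇒f≡ u v (suc-injective e)

  f≡⇒label≡′ : ∀ u v → f u ≡ f v → label′ u ≡ label′ v
  f≡⇒label≡′ zero    zero    _ = refl
  f≡⇒label≡′ zero    (suc v) e = contradiction (v , e) f0-new
  f≡⇒label≡′ (suc u) zero    e = contradiction (u , sym e) f0-new
  f≡⇒label≡′ (suc u) (suc v) e = cong suc (f≡⇒label≡ u v e)

slack : ∀ {p} {P : Set p} → Dec P → Fin 2
slack (yes _) = zero
slack (no _)  = suc zero

funToFin-injective : ∀ {m k} {f g : Fin m → Fin k} → funToFin f ≡ funToFin g → ∀ i → f i ≡ g i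
funToFin-injective {f = f} {g} e i = begin
  f i                     ≡⟨ finToFun-funToFin f i ⟨
  finToFun (funToFin f) i ≡⟨ cong (λ z → finToFun z i) e ⟩
  finToFun (funToFin g) i ≡⟨ finToFun-funToFin g i ⟩
  g i                     ∎
  where open ≡-Reasoning

module Refinement {n ν} (G : Graph n) (t : Fin n → Fin ν)
  (sameType : ∀ {u v} → t u ≡ t v → SameType G u v) (β : LCC n) where

  deg : Subset n → Fin n → ℕ
  deg X v = ∣ X ∩ N G v ∣

  class : Fin ν → List (Fin n)
  class c = filter (λ w → t w ≟ c) (allFin n)

  ∈-class : ∀ v → v ∈ˡ class (t v)
  ∈-class v = ∈-filter⁺ (λ w → t w ≟ t v) (∈-allFin v) refl

  maxLo : Fin ν → ℕ
  maxLo c = max 0 (map (lo ∘ β) (class c))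

  minHi : Fin ν → ℕ
  minHi c = min n (map (hi ∘ β) (class c))

  lo≤maxLo : ∀ v → lo (β v) ≤ maxLo (t v)
  lo≤maxLo v = All.lookup (xs≤max 0 _) (∈-map⁺ (lo ∘ β) (∈-class v))

  minHi≤hi : ∀ v → minHi (t v) ≤ hi (β v)
  minHi≤hi v = All.lookup (min≤xs n _) (∈-map⁺ (hi ∘ β) (∈-class v))

  classmates : ∀ {c} → All (λ w → t w ≡ c) (class c)
  classmates {c} = all-filter (λ w → t w ≟ c) (allFin n)

  maxLo≤1+deg : ∀ X → (∀ w → lo (β w) ≤ deg X w) → ∀ v → maxLo (t v) ≤ suc (deg X v)
  maxLo≤1+deg X lo-sat v = max≤v⁺ z≤n (map⁺ (All.map lo≤1+deg classmates))
    where
    lo≤1+deg : ∀ {w} → t w ≡ t v → lo (β w) ≤ suc (deg X v)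
    lo≤1+deg {w} tw≡tv = ≤-trans (lo-sat w) (sameType⇒∣X∩N∣≤1+∣X∩N∣ G X (sameType tw≡tv))

  deg∸1≤minHi : ∀ X → (∀ w → deg X w ≤ hi (β w)) → ∀ v → deg X v ∸ 1 ≤ minHi (t v)
  deg∸1≤minHi X hi-sat v =
    v≤min⁺ (≤-trans (m∸n≤m (deg X v) 1) (∣p∣≤n (X ∩ N G v))) (map⁺ (All.map deg∸1≤hi classmates))
    where
    deg∸1≤hi : ∀ {w} → t w ≡ t v → deg X v ∸ 1 ≤ hi (β w)
    deg∸1≤hi {w} tw≡tv =
      ≤-trans (∸-monoˡ-≤ 1 (sameType⇒∣X∩N∣≤1+∣X∩N∣ G X (sameType (sym tw≡tv)))) (hi-sat w)

  loSlack : Fin n → Fin 2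
  loSlack v = slack (lo (β v) ℕ.≟ maxLo (t v))

  hiSlack : Fin n → Fin 2
  hiSlack v = slack (minHi (t v) ℕ.≟ hi (β v))

  slacks : Fin n → Fin 4
  slacks v = combine (loSlack v) (hiSlack v)

  refine : Fin ν → Fin 2 → Fin 2 → Interval n
  refine c s s′ = [ maxLo c ∸ toℕ s , (toℕ s′ + minHi c) ⊓ n ]⟨ m⊓n≤n _ n ⟩

  β′ : LCC n
  β′ v = refine (t v) (loSlack v) (hiSlack v)

  β′-cong : ∀ {u v} → t u ≡ t v → slacks u ≡ slacks v → β′ u ≡ β′ v
  β′-cong {u} {v} tu≡tv e with combine-injective (loSlack u) (hiSlack u) (loSlack v) (hiSlack v) e
  ... | lo≡ , hi≡ = trans (cong (λ c → refine c (loSlack u) (hiSlack u)) tu≡tv)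
                          (cong₂ (refine (t v)) lo≡ hi≡)

  lo′≤deg : ∀ X → (∀ w → lo (β w) ≤ deg X w) → ∀ v → lo (β′ v) ≤ deg X v
  lo′≤deg X lo-sat v with lo (β v) ℕ.≟ maxLo (t v)
  ... | yes lo≡maxLo = subst (_≤ deg X v) lo≡maxLo (lo-sat v)
  ... | no _         = ∸-monoˡ-≤ 1 (maxLo≤1+deg X lo-sat v)

  lo≤deg : ∀ X v → lo (β′ v) ≤ deg X v → lo (β v) ≤ deg X v
  lo≤deg X v with lo (β v) ℕ.≟ maxLo (t v)
  ... | yes lo≡maxLo = subst (_≤ deg X v) (sym lo≡maxLo)
  ... | no lo≢maxLo  = ≤-trans (∸-monoˡ-≤ 1 (≤∧≢⇒< (lo≤maxLo v) lo≢maxLo))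

  deg≤hi′ : ∀ X → (∀ w → deg X w ≤ hi (β w)) → ∀ v → deg X v ≤ hi (β′ v)
  deg≤hi′ X hi-sat v with minHi (t v) ℕ.≟ hi (β v)
  ... | yes minHi≡hi = ⊓-glb (subst (deg X v ≤_) (sym minHi≡hi) (hi-sat v)) (∣p∣≤n (X ∩ N G v))
  ... | no _         = ⊓-glb (≤-trans (m≤n+m∸n (deg X v) 1) (s≤s (deg∸1≤minHi X hi-sat v)))
                             (∣p∣≤n (X ∩ N G v))

  deg≤hi : ∀ X v → deg X v ≤ hi (β′ v) → deg X v ≤ hi (β v)
  deg≤hi X v sat′ with minHi (t v) ℕ.≟ hi (β v)
  ... | yes minHi≡hi = subst (deg X v ≤_) minHi≡hi (≤-trans sat′ (m⊓n≤m _ n))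
  ... | no minHi≢hi  = ≤-trans sat′ (≤-trans (m⊓n≤m _ n) (≤∧≢⇒< (minHi≤hi v) minHi≢hi))

  satisfies⇔ : ∀ X → Satisfies G X β ⇔ Satisfies G X β′
  satisfies⇔ X = mk⇔
    (λ sat v → lo′≤deg X (proj₁ ∘ sat) v , deg≤hi′ X (proj₂ ∘ sat) v)
    (λ sat′ v → lo≤deg X v (proj₁ (sat′ v)) , deg≤hi X v (proj₂ (sat′ v)))

lemma3p9 : ∀ {n} (G : Graph n) (ν ℓ : ℕ) → HasND G ν → (α : Fin ℓ → LCC n) →
  ∃ λ (k : ℕ) → Σ (Fin n → Fin k) λ t → Σ (Fin ℓ → LCC n) λ α′ →
    IsNDDecomp G k t × k ≤ ν * 4 ^ ℓ ×
    (∀ i → Uniform t (α′ i)) ×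
    (∀ (X : Fin ℓ → Subset n) →
      (∀ i → Satisfies G (X i) (α i)) ⇔ (∀ i → Satisfies G (X i) (α′ i)))
lemma3p9 {n} G ν ℓ ((t₀ , _ , sameType₀) , _) α =
  size , label , α′ , (surjective , sameType) , size≤ , uniform ,
  λ X → mk⇔ (λ sat i → Equivalence.to (R.satisfies⇔ i (X i)) (sat i))
            (λ sat′ i → Equivalence.from (R.satisfies⇔ i (X i)) (sat′ i))
  where
  module R (i : Fin ℓ) = Refinement G t₀ (classmates⇒sameType G sameType₀) (α i)

  α′ : Fin ℓ → LCC n
  α′ i = R.β′ i

  code : Fin n → Fin (ν * 4 ^ ℓ)
  code v = combine (t₀ v) (funToFin (λ i → R.slacks i v))

  open ImageLabelling (imageLabelling code)

  code-injective : ∀ {u v} → code u ≡ code v → t₀ u ≡ t₀ v × ∀ i → R.slacks i u ≡ R.slacks i v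
  code-injective {u} {v} e with combine-injective (t₀ u) _ (t₀ v) _ e
  ... | t₀≡ , slacks≡ = t₀≡ , funToFin-injective slacks≡

  sameType : ∀ u v → u ≢ v → label u ≡ label v → SameType G u v
  sameType u v u≢v e = sameType₀ u v u≢v (proj₁ (code-injective (label≡⇒f≡ u v e)))

  uniform : ∀ i → Uniform label (α′ i)
  uniform i u v e with code-injective (label≡⇒f≡ u v e)
  ... | t₀≡ , slacks≡ = R.β′-cong i t₀≡ (slacks≡ i)
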